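{- Let $\mathcal V$ be a loop-producing variety and let $k\geq1$, $s\geq1$. If $\mathcal V$ satisfies the $\mathrm{CLQP}(k,0,s)$ loop condition, then $\mathcal V$ satisfies the $\mathrm{CLQP}(k+1,s,1)$ loop condition.
   Context: Fix a symbol $\bot$. For integers $k\geq1$, $l\geq0$, $s\geq1$, the digraph $\mathrm{CLQP}(k,l,s)$ is defined as follows. Let $\mathcal A$ be an alphabet of size $s$ and $\mathcal L$ an alphabet of size $l$ not containing $\bot$. The vertices are sequences $(a_1,l_1,a_2,l_2,\dots,l_{k-1},a_k)$ with all $a_i\in\mathcal A$, all $l_i\in\mathcal L\cup\{\bot\}$, such that (1) if $l_i=l_j\in\mathcal L$ then $i=j$, and (2) for all $i<j$: $a_i=a_j$ if and only if $l_i,\dots,l_{j-1}\in\mathcal L$. There is an edge from $n_1$ to $n_2$ if there is a vertex $n$ of $\mathrm{CLQP}(k+1,l,s)$ such that $n_1$ is the prefix of $n$ of length $2k-1$ and $n_2$ is the suffix of $n$ of length $2k-1$. A loop condition is given by a finite set of variables $V$ and two $n$-tuples $x_1,\dots,x_n$, $y_1,\dots,y_n$ from $V$; a variety satisfies it if it has a term $t$ with $t(x_1,\dots,x_n)=t(y_1,\dots,y_n)$ identically; its digraph is $(V,\{(x_i,y_i)\})$. For a finite digraph $\mathbb H$, the $\mathbb H$ loop condition is any loop condition whose digraph is isomorphic to $\mathbb H$. A loop condition is non-trivial if its digraph has no loop; a variety is loop-producing if it satisfies some non-trivial loop condition. -}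

module Defs where

open import Data.Nat using (ℕ; zero; suc; _<_; _≤_)
open import Data.Fin using (Fin; toℕ)
open import Data.Vec using (Vec; lookup; init; tail)
open import Data.Maybe using (Maybe; just)
open import Data.Product using (Σ; ∃; _×_; _,_)
open import Relation.Binary.PropositionalEquality using (_≡_; _≢_)
open import Function using (_∘_)

record Signature : Set₁ where
  field
    Op    : Set
    arity : Op → ℕ
open Signature public

data Term (S : Signature) (X : Set) : Set where
  var : X → Term S X
  op  : (f : Op S) → (Fin (arity S f) → Term S X) → Term S X

_⟪_⟫ : {S : Signature} {X Y : Set} → Term S X → (X → Term S Y) → Term S Y
var x   ⟪ σ ⟫ = σ x
op f ts ⟪ σ ⟫ = op f (λ i → ts i ⟪ σ ⟫)

record Algebra (S : Signature) : Set₁ where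
  field
    Carrier : Set
    interp  : (f : Op S) → (Fin (arity S f) → Carrier) → Carrier
open Algebra public

eval : {S : Signature} {X : Set} (A : Algebra S) → (X → Carrier A) → Term S X → Carrier A
eval A ρ (var x)   = ρ x
eval A ρ (op f ts) = interp A f (λ i → eval A ρ (ts i))

-- Varieties, presented (Birkhoff) as the class of models of a set of
-- identities over countably many variables.

record Variety : Set₁ where
  field
    sig    : Signature
    Axiom  : Set
    lhs    : Axiom → Term sig ℕ
    rhs    : Axiom → Term sig ℕ
open Variety public

_∈V_ : {V : Variety} → Algebra (sig V) → Variety → Set
_∈V_ {V} A _ = (a : Axiom V) (ρ : ℕ → Carrier A) → eval A ρ (lhs V a) ≡ eval A ρ (rhs V a)

Holds : (V : Variety) {X : Set} → Term (sig V) X → Term (sig V) X → Set₁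
Holds V {X} u v = (A : Algebra (sig V)) → _∈V_ {V} A V → (ρ : X → Carrier A) → eval A ρ u ≡ eval A ρ v

-- variables Fin m, pairs (x i, y i) for i : Fin n
record LoopCondition : Set where
  field
    m n : ℕ
    x y : Fin n → Fin m
open LoopCondition public

Satisfies : Variety → LoopCondition → Set₁
Satisfies V L = Σ (Term (sig V) (Fin (n L))) λ t →
  Holds V (t ⟪ var ∘ x L ⟫) (t ⟪ var ∘ y L ⟫)

LCEdge : (L : LoopCondition) → Fin (m L) → Fin (m L) → Set
LCEdge L u v = ∃ λ i → x L i ≡ u × y L i ≡ v

NonTrivial : LoopCondition → Set
NonTrivial L = (i : Fin (n L)) → x L i ≢ y L i

LoopProducing : Variety → Set₁
LoopProducing V = Σ LoopCondition λ L → NonTrivial L × Satisfies V L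

-- Digraphs: vertices are the elements of Raw satisfying Valid

record Digraph : Set₁ where
  field
    Raw   : Set
    Valid : Raw → Set
    Edge  : Raw → Raw → Set
open Digraph public

IsoToLC : LoopCondition → Digraph → Set
IsoToLC L H = Σ (Fin (m L) → Raw H) λ f →
    ((u : Fin (m L)) → Valid H (f u))
  × ((u v : Fin (m L)) → f u ≡ f v → u ≡ v)
  × ((w : Raw H) → Valid H w → ∃ λ u → f u ≡ w)
  × ((u v : Fin (m L)) → (LCEdge L u v → Edge H (f u) (f v)) × (Edge H (f u) (f v) → LCEdge L u v))

SatisfiesDigraph : Variety → Digraph → Set₁
SatisfiesDigraph V H = Σ LoopCondition λ L → IsoToLC L H × Satisfies V L

-- CLQP(k,l,s) with k = suc n; A = Fin s, L = Fin l, ⊥ = nothing.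
-- A raw vertex (a_1,l_1,...,l_{k-1},a_k) is a pair of vectors.

CLQPRaw : ℕ → ℕ → ℕ → Set
CLQPRaw n l s = Vec (Fin s) (suc n) × Vec (Maybe (Fin l)) n

CLQPValid : (n l s : ℕ) → CLQPRaw n l s → Set
CLQPValid n l s (a , lab) =
    ((i j : Fin n) (c : Fin l) → lookup lab i ≡ just c → lookup lab j ≡ just c → i ≡ j)
  × ((i j : Fin (suc n)) → toℕ i < toℕ j →
       (lookup a i ≡ lookup a j →
          (p : Fin n) → toℕ i ≤ toℕ p → toℕ p < toℕ j → ∃ λ c → lookup lab p ≡ just c)
     × (((p : Fin n) → toℕ i ≤ toℕ p → toℕ p < toℕ j → ∃ λ c → lookup lab p ≡ just c) →
          lookup a i ≡ lookup a j))

CLQPEdge : (n l s : ℕ) → CLQPRaw n l s → CLQPRaw n l s → Set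
CLQPEdge n l s u v = Σ (CLQPRaw (suc n) l s) λ w → CLQPValid (suc n) l s w ×
  (let (a , lab) = w in (init a , init lab) ≡ u × (tail a , tail lab) ≡ v)

-- CLQP n l s is the digraph CLQP(n+1, l, s) of the paper
CLQP : ℕ → ℕ → ℕ → Digraph
CLQP n l s = record { Raw = CLQPRaw n l s ; Valid = CLQPValid n l s ; Edge = CLQPEdge n l s }

module Submission where

-- The digraphs CLQP(k,0,s) and CLQP(k+1,s,1) are isomorphic, so the two
-- loop conditions are literally the same loop condition up to renaming.
--
-- * A vertex of CLQP(k,0,s) has no labels other than ⊥, so the validity
--   condition says exactly that its letters a₁,…,a_k are pairwise distinct.
-- * A vertex of CLQP(k+1,s,1) has a single letter, so all positions must be
--   linked by labels: its labels l₁,…,l_k are all proper, and pairwise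
--   distinct, i.e. they form an injective word of length k over s symbols.
--
-- The map `relabel` sending (a₁,⊥,…,⊥,a_k) to (∗,a₁,∗,…,∗,a_k,∗) is therefore
-- a bijection on valid vertices; it commutes with taking prefixes and
-- suffixes, hence preserves and reflects edges.  A general transport lemma
-- (an isomorphism of digraphs carries any loop condition for the first
-- digraph to one for the second) then gives the theorem.
--
-- As in Defs, the index k of `CLQP k l s` denotes
-- the paper's CLQP(k+1,l,s).

open import Defs
open import Data.Nat using (ℕ; zero; suc; _≤_; _<_; z≤n; s≤s)
open import Data.Nat.Properties using (<-cmp; <-≤-trans; ≤-pred; <-irrefl; ≤-reflexive)
open import Data.Fin using (Fin; toℕ; fromℕ<; fromℕ) renaming (zero to fzero; suc to fsuc)
open import Data.Fin.Properties using (¬Fin0; toℕ-fromℕ<; toℕ-injective; toℕ<n; toℕ-fromℕ)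
open import Data.Vec using (Vec; []; _∷_; lookup; init; tail; map; replicate)
open import Data.Vec.Properties using (lookup-map; ∷-injective)
open import Data.Maybe using (Maybe; just; nothing)
open import Data.Maybe.Properties using (just-injective)
open import Data.Product using (Σ; ∃; _×_; _,_; proj₁; proj₂)
open import Data.Empty using (⊥-elim)
open import Relation.Binary using (tri<; tri≈; tri>)
open import Relation.Nullary using (Irrelevant)
open import Relation.Binary.PropositionalEquality
open import Function using (_∘_)

private
  variable
    A B : Set
    k l s : ℕ

Vec-irrelevant : Irrelevant A → Irrelevant (Vec A k)
Vec-irrelevant irr []       []       = refl
Vec-irrelevant irr (x ∷ xs) (y ∷ ys) = cong₂ _∷_ (irr x y) (Vec-irrelevant irr xs ys)

Fin1-irrelevant : Irrelevant (Fin 1)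
Fin1-irrelevant fzero fzero = refl

noLabel-irrelevant : Irrelevant (Maybe (Fin 0))
noLabel-irrelevant nothing  nothing = refl
noLabel-irrelevant (just ()) _
noLabel-irrelevant nothing  (just ())

map-injective : {f : A → B} → (∀ {x y} → f x ≡ f y → x ≡ y) →
  (xs ys : Vec A k) → map f xs ≡ map f ys → xs ≡ ys
map-injective f-inj []       []       _  = refl
map-injective f-inj (x ∷ xs) (y ∷ ys) eq =
  let fx≡fy , fxs≡fys = ∷-injective eq in
  cong₂ _∷_ (f-inj fx≡fy) (map-injective f-inj xs ys fxs≡fys)

map-init : (f : A → B) (xs : Vec A (suc k)) → init (map f xs) ≡ map f (init xs)
map-init {k = zero}  f (x ∷ []) = refl
map-init {k = suc k} f (x ∷ xs) = cong (f x ∷_) (map-init f xs)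

allJust⇒map-just : (w : Vec (Maybe A) k) → (∀ p → ∃ λ c → lookup w p ≡ just c) →
  Σ (Vec A k) λ b → w ≡ map just b
allJust⇒map-just []      _ = [] , refl
allJust⇒map-just (x ∷ w) h with h fzero | allJust⇒map-just w (h ∘ fsuc)
... | c , refl | b , refl = c ∷ b , refl

Distinct : Vec A k → Set
Distinct v = ∀ i j → lookup v i ≡ lookup v j → i ≡ j

-- Between two positions i < j of the letters there is a label position p
-- with i ≤ p < j (namely p = i).
labelBetween : (i j : Fin (suc k)) → toℕ i < toℕ j →
  Σ (Fin k) λ p → toℕ i ≤ toℕ p × toℕ p < toℕ j
labelBetween {k} i j i<j = fromℕ< i<k , ≤-reflexive (sym p≡i) , subst (_< toℕ j) (sym p≡i) i<j
  where
  i<k : toℕ i < k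
  i<k = <-≤-trans i<j (≤-pred (toℕ<n j))
  p≡i : toℕ (fromℕ< i<k) ≡ toℕ i
  p≡i = toℕ-fromℕ< i<k

-- Without labels, two letters at positions i < j can never coincide: that
-- would force a proper label between them.
valid₀⇒noRepeat : (v : CLQPRaw k 0 s) → CLQPValid k 0 s v → (i j : Fin (suc k)) →
  toℕ i < toℕ j → lookup (proj₁ v) i ≢ lookup (proj₁ v) j
valid₀⇒noRepeat v (_ , linked) i j i<j eq =
  let p , i≤p , p<j = labelBetween i j i<j in
  ¬Fin0 (proj₁ (proj₁ (linked i j i<j) eq p i≤p p<j))

valid₀⇒distinct : (v : CLQPRaw k 0 s) → CLQPValid k 0 s v → Distinct (proj₁ v)
valid₀⇒distinct v valid i j eq with <-cmp (toℕ i) (toℕ j)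
... | tri< i<j _ _ = ⊥-elim (valid₀⇒noRepeat v valid i j i<j eq)
... | tri≈ _ i≡j _ = toℕ-injective i≡j
... | tri> _ _ j<i = ⊥-elim (valid₀⇒noRepeat v valid j i j<i (sym eq))

distinct⇒valid₀ : (a : Vec (Fin s) (suc k)) (lab : Vec (Maybe (Fin 0)) k) →
  Distinct a → CLQPValid k 0 s (a , lab)
distinct⇒valid₀ a lab distinct = (λ _ _ ()) , λ i j i<j →
    (λ eq → ⊥-elim (<-irrefl (cong toℕ (distinct i j eq)) i<j))
  , (λ allLabelled → let p , i≤p , p<j = labelBetween i j i<j in
                     ⊥-elim (¬Fin0 (proj₁ (allLabelled p i≤p p<j))))

-- With a single letter, the first and last letters agree, so every label
-- position carries a proper label.
valid₁⇒allLabelled : (v : CLQPRaw (suc k) l 1) → CLQPValid (suc k) l 1 v →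
  ∀ p → ∃ λ c → lookup (proj₂ v) p ≡ just c
valid₁⇒allLabelled {k} v (_ , linked) p =
  proj₁ (linked fzero last 0<last) (Fin1-irrelevant _ _) p z≤n p<last
  where
  last : Fin (suc (suc k))
  last = fromℕ (suc k)
  0<last : 0 < toℕ last
  0<last = subst (0 <_) (sym (toℕ-fromℕ (suc k))) (s≤s z≤n)
  p<last : toℕ p < toℕ last
  p<last = subst (toℕ p <_) (sym (toℕ-fromℕ (suc k))) (toℕ<n p)

valid₁⇒distinctLabels : (v : CLQPRaw (suc k) l 1) → CLQPValid (suc k) l 1 v →
  Σ (Vec (Fin l) (suc k)) λ b → proj₂ v ≡ map just b × Distinct b
valid₁⇒distinctLabels v valid with allJust⇒map-just (proj₂ v) (valid₁⇒allLabelled v valid)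
... | b , refl = b , refl , λ i j eq →
  proj₁ valid i j (lookup b i) (lookup-map i just b)
    (trans (lookup-map j just b) (cong just (sym eq)))

distinctLabels⇒valid₁ : (a : Vec (Fin 1) (suc k)) (b : Vec (Fin l) k) →
  Distinct b → CLQPValid k l 1 (a , map just b)
distinctLabels⇒valid₁ a b distinct =
    (λ i j c eqᵢ eqⱼ → distinct i j (just-injective (begin
       just (lookup b i)     ≡⟨ sym (lookup-map i just b) ⟩
       lookup (map just b) i ≡⟨ trans eqᵢ (sym eqⱼ) ⟩
       lookup (map just b) j ≡⟨ lookup-map j just b ⟩
       just (lookup b j)     ∎)))
  , λ _ _ _ → (λ _ p _ _ → lookup b p , lookup-map p just b) , (λ _ → Fin1-irrelevant _ _)
  where open ≡-Reasoning

record DigraphIso (G H : Digraph) : Set where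
  field
    to         : Raw G → Raw H
    valid      : ∀ u → Valid G u → Valid H (to u)
    injective  : ∀ u v → Valid G u → Valid G v → to u ≡ to v → u ≡ v
    surjective : ∀ w → Valid H w → ∃ λ u → Valid G u × to u ≡ w
    preserves  : ∀ u v → Valid G u → Valid G v → Edge G u v → Edge H (to u) (to v)
    reflects   : ∀ u v → Valid G u → Valid G v → Edge H (to u) (to v) → Edge G u v

isoToLC-transport : {L : LoopCondition} {G H : Digraph} →
  DigraphIso G H → IsoToLC L G → IsoToLC L H
isoToLC-transport {H = H} iso (f , f-valid , f-inj , f-surj , f-edge) =
    to ∘ f
  , (λ u → valid (f u) (f-valid u))
  , (λ u v eq → f-inj u v (injective (f u) (f v) (f-valid u) (f-valid v) eq))
  , surj
  , λ u v → (preserves (f u) (f v) (f-valid u) (f-valid v) ∘ proj₁ (f-edge u v))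
          , (proj₂ (f-edge u v) ∘ reflects (f u) (f v) (f-valid u) (f-valid v))
  where
  open DigraphIso iso
  surj : ∀ w → Valid H w → ∃ λ u → to (f u) ≡ w
  surj w w-valid with surjective w w-valid
  ... | v , v-valid , refl with f-surj v v-valid
  ... | u , refl = u , refl

satisfiesDigraph-transport : {V : Variety} {G H : Digraph} →
  DigraphIso G H → SatisfiesDigraph V G → SatisfiesDigraph V H
satisfiesDigraph-transport iso (L , L≅G , sat) = L , isoToLC-transport iso L≅G , sat

prefix : CLQPRaw (suc k) l s → CLQPRaw k l s
prefix (a , lab) = init a , init lab

suffix : CLQPRaw (suc k) l s → CLQPRaw k l s
suffix (a , lab) = tail a , tail lab

relabel : CLQPRaw k 0 s → CLQPRaw (suc k) s 1
relabel (a , _) = replicate _ fzero , map just a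

-- Labels of a label-free vertex carry no information, so `relabel` is injective.
relabel-injective : (u v : CLQPRaw k 0 s) → relabel u ≡ relabel v → u ≡ v
relabel-injective (a , lab) (a′ , lab′) eq
  with map-injective just-injective a a′ (cong proj₂ eq)
... | refl = cong (a ,_) (Vec-irrelevant noLabel-irrelevant lab lab′)

relabel-valid : (u : CLQPRaw k 0 s) → CLQPValid k 0 s u → CLQPValid (suc k) s 1 (relabel u)
relabel-valid u valid = distinctLabels⇒valid₁ (replicate _ fzero) (proj₁ u) (valid₀⇒distinct u valid)

relabel-surjective : (w : CLQPRaw (suc k) s 1) → CLQPValid (suc k) s 1 w →
  ∃ λ u → CLQPValid k 0 s u × relabel u ≡ w
relabel-surjective (a , lab) valid with valid₁⇒distinctLabels (a , lab) valid
... | b , refl , distinct =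
  (b , replicate _ nothing) , distinct⇒valid₀ b (replicate _ nothing) distinct ,
  cong (_, map just b) (Vec-irrelevant Fin1-irrelevant (replicate _ fzero) a)

relabel-prefix : (w : CLQPRaw (suc k) 0 s) → prefix (relabel w) ≡ relabel (prefix w)
relabel-prefix (a , _) =
  cong₂ _,_ (Vec-irrelevant Fin1-irrelevant (init (replicate _ fzero)) (replicate _ fzero))
            (map-init just a)

relabel-suffix : (w : CLQPRaw (suc k) 0 s) → suffix (relabel w) ≡ relabel (suffix w)
relabel-suffix (_ ∷ _ , _) = refl

relabel-preservesEdges : (u v : CLQPRaw k 0 s) →
  CLQPEdge k 0 s u v → CLQPEdge (suc k) s 1 (relabel u) (relabel v)
relabel-preservesEdges _ _ (w , valid , refl , refl) =
  relabel w , relabel-valid w valid , relabel-prefix w , relabel-suffix w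

relabel-reflectsEdges : (u v : CLQPRaw k 0 s) →
  CLQPEdge (suc k) s 1 (relabel u) (relabel v) → CLQPEdge k 0 s u v
relabel-reflectsEdges u v (w′ , valid′ , pre , suf) with relabel-surjective w′ valid′
... | w , valid , refl =
    w , valid
  , relabel-injective _ u (trans (sym (relabel-prefix w)) pre)
  , relabel-injective _ v (trans (sym (relabel-suffix w)) suf)

relabelIso : (k s : ℕ) → DigraphIso (CLQP k 0 s) (CLQP (suc k) s 1)
relabelIso k s = record
  { to         = relabel
  ; valid      = relabel-valid
  ; injective  = λ u v _ _ → relabel-injective u v
  ; surjective = relabel-surjective
  ; preserves  = λ u v _ _ → relabel-preservesEdges u v
  ; reflects   = λ u v _ _ → relabel-reflectsEdges u v
  }

mainTheorem7 : (V : Variety) → LoopProducing V → (n s : ℕ) → 1 ≤ s →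
    SatisfiesDigraph V (CLQP n 0 s) → SatisfiesDigraph V (CLQP (suc n) s 1)
mainTheorem7 V _ n s _ = satisfiesDigraph-transport {V} (relabelIso n s)
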